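{- If $N,n,r,s$ are positive integers with $n>3$, $1\le s\le 2r/3$ and $R_3(n;r,s)>N>0$, then $R_4(2n^2;r,s)>2^N$.
   Context: For positive integers $n,k,r,s$ with $n>k$ and $r>s$, an $(r,s)$-coloring of the complete $k$-uniform hypergraph $K_N^{(k)}$ is a map $\chi:E(K_N^{(k)})\to\binom{[r]}{s}$. A monochromatic $n$-clique is a set of $n$ vertices such that all $\binom{n}{k}$ edges within it contain a common color. $R_k(n;r,s)$ is the minimum $N$ such that every $(r,s)$-coloring of $K_N^{(k)}$ contains a monochromatic $n$-clique. -}

module Defs where

open import Data.Nat using (ℕ; _≤_)
open import Data.Fin using (Fin)
open import Data.Fin.Subset using (Subset; _⊆_; _∈_; ∣_∣)
open import Data.Product using (Σ; ∃; _×_)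
open import Relation.Binary.PropositionalEquality using (_≡_)
open import Relation.Nullary using (¬_)

-- Vertex set of K_N^(k) is Fin N; an edge is a k-element subset of Fin N.
-- Colours are Fin r; a colour value is an s-element subset of Fin r.
-- A colouring is a function on subsets of Fin N whose values on k-subsets
-- are s-subsets of Fin r (values on other subsets are irrelevant).
IsRSColoring : (k N r s : ℕ) → (Subset N → Subset r) → Set
IsRSColoring k N r s χ = ∀ (e : Subset N) → ∣ e ∣ ≡ k → ∣ χ e ∣ ≡ s

HasMonoClique : (k n N r : ℕ) → (Subset N → Subset r) → Set
HasMonoClique k n N r χ =
  Σ (Subset N) λ S → ∣ S ∣ ≡ n × ∃ λ (c : Fin r) →
    ∀ (e : Subset N) → e ⊆ S → ∣ e ∣ ≡ k → c ∈ χ e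

RamseyProperty : (k n r s N : ℕ) → Set
RamseyProperty k n r s N =
  ∀ (χ : Subset N → Subset r) → IsRSColoring k N r s χ → HasMonoClique k n N r χ

-- R_k(n;r,s) > M : since R_k(n;r,s) is the minimum N with the Ramsey
-- property, it exceeds M iff no N ≤ M has the property.
RamseyGreater : (k n r s M : ℕ) → Set
RamseyGreater k n r s M = ∀ N → N ≤ M → ¬ RamseyProperty k n r s N

-- Stepping up (Erdős–Hajnal–Rado). Read a vertex a < 2 ^ N as a bit string and let δ(a, b) < N be the
-- highest bit in which a and b differ; for a < b < c, δ(a, c) = max (δ(a, b), δ(b, c)) and
-- δ(a, b) ≠ δ(b, c). Choose s-sets A, B, C of colours without a common colour, possible as 3s ≤ 2r.
-- Colour a 4-set a < b < c < d whose consecutive δ-values are x, y, z by χ₃{x, y, z} when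
-- x < y < z or x > y > z, by A when y is a peak, and by B or C when y is a valley with x < z or x > z.
-- A colour shared by a monochromatic 4-clique of size 2n² misses one of A, B, C, so the δ-values along
-- the clique avoid the corresponding pattern. Without peaks the consecutive δ-values fall and then rise;
-- without valleys of one kind, splitting repeatedly at the largest δ-value gives a rising or a falling run.
-- Either way n consecutive δ-values are monotone, and they form a monochromatic n-clique of χ₃.
module Submission where

open import Defs
open import Data.Bool using (true; false)
open import Data.Empty using (⊥; ⊥-elim)
open import Data.Fin using (Fin; toℕ) renaming (zero to fzero; suc to fsuc)
open import Data.Fin.Properties using (toℕ<n; toℕ-fromℕ<; toℕ-injective)
open import Data.Fin.Subset using (Subset; ∣_∣) renaming (_∈_ to _∈ₛ_; _⊆_ to _⊆ₛ_)
open import Data.Fin.Subset.Properties using (⊆-antisym) renaming (_∈?_ to _∈ₛ?_)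
open import Data.List using (List; []; _∷_; _++_; map; length; applyUpTo; applyDownFrom)
open import Data.List.Membership.Propositional using (_∈_)
open import Data.List.Membership.Propositional.Properties
  using (∈-map⁺; ∈-map⁻; ∈-++⁻; ∈-applyUpTo⁻; ∈-applyDownFrom⁻)
open import Data.List.Properties using (length-map; length-++; length-applyUpTo; length-applyDownFrom)
open import Data.List.Relation.Unary.All as All using (All; []; _∷_)
import Data.List.Relation.Unary.All.Properties as All
open import Data.List.Relation.Unary.AllPairs as AllPairs using (AllPairs; []; _∷_)
import Data.List.Relation.Unary.AllPairs.Properties as AllPairs
open import Data.List.Relation.Unary.Any using (here; there)
open import Data.Nat
open import Data.Nat.Properties
open import Data.List.Membership.DecPropositional _≟_ using (_∈?_)
open import Data.Product using (∃; _×_; _,_; proj₁; proj₂)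
open import Data.Sum using (_⊎_; inj₁; inj₂)
open import Data.Vec as Vec using ([]; _∷_; tabulate)
open import Data.Vec.Properties using (lookup∘tabulate; []=⇒lookup; lookup⇒[]=)
open import Function using (_∘_; flip)
open import Relation.Nullary using (¬_; Dec; yes; no; contradiction)
open import Relation.Nullary.Decidable using (does; dec-true; dec-yes; _×-dec_)
open import Relation.Binary using (tri<; tri≈; tri>)
open import Relation.Binary.PropositionalEquality

-- Subsets of Fin n as increasing lists

Increasing : List ℕ → Set
Increasing = AllPairs _<_

increasing-triple : ∀ {x y z} → x < y → y < z → Increasing (x ∷ y ∷ z ∷ [])
increasing-triple x<y y<z = (x<y ∷ <-trans x<y y<z ∷ []) ∷ (y<z ∷ []) ∷ [] ∷ []

increasing-unique : ∀ {xs ys} → Increasing xs → Increasing ys →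
  (∀ {x} → x ∈ xs → x ∈ ys) → (∀ {x} → x ∈ ys → x ∈ xs) → xs ≡ ys
increasing-unique {[]} {[]} _ _ _ _ = refl
increasing-unique {[]} {y ∷ _} _ _ _ ys⊆ = contradiction (ys⊆ (here refl)) λ ()
increasing-unique {x ∷ _} {[]} _ _ xs⊆ _ = contradiction (xs⊆ (here refl)) λ ()
increasing-unique {x ∷ xs} {y ∷ ys} (x< ∷ xs↗) (y< ∷ ys↗) xs⊆ ys⊆ =
  cong₂ _∷_ x≡y (increasing-unique xs↗ ys↗ tail⊆ tail⊇)
  where
  x≡y : x ≡ y
  x≡y with xs⊆ (here refl) | ys⊆ (here refl)
  ... | here x≡y | _        = x≡y
  ... | there _  | here y≡x = sym y≡x
  ... | there x∈ | there y∈ = contradiction (All.lookup x< y∈) (<-asym (All.lookup y< x∈))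
  tail⊆ : ∀ {z} → z ∈ xs → z ∈ ys
  tail⊆ z∈ with xs⊆ (there z∈)
  ... | here z≡y   = ⊥-elim (<-irrefl (trans x≡y (sym z≡y)) (All.lookup x< z∈))
  ... | there z∈ys = z∈ys
  tail⊇ : ∀ {z} → z ∈ ys → z ∈ xs
  tail⊇ z∈ with ys⊆ (there z∈)
  ... | here z≡x   = ⊥-elim (<-irrefl (trans (sym x≡y) (sym z≡x)) (All.lookup y< z∈))
  ... | there z∈xs = z∈xs

elements : ∀ {n} → Subset n → List ℕ
elements []          = []
elements (true  ∷ p) = 0 ∷ map suc (elements p)
elements (false ∷ p) = map suc (elements p)

∣p∣≡length-elements : ∀ {n} (p : Subset n) → ∣ p ∣ ≡ length (elements p)
∣p∣≡length-elements []          = refl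
∣p∣≡length-elements (true  ∷ p) = cong suc (trans (∣p∣≡length-elements p) (sym (length-map suc (elements p))))
∣p∣≡length-elements (false ∷ p) = trans (∣p∣≡length-elements p) (sym (length-map suc (elements p)))

elements-increasing : ∀ {n} (p : Subset n) → Increasing (elements p)
elements-increasing []          = []
elements-increasing (true  ∷ p) =
  All.map⁺ (All.universal (λ _ → z<s) (elements p)) ∷ AllPairs.map⁺ (AllPairs.map s<s (elements-increasing p))
elements-increasing (false ∷ p) = AllPairs.map⁺ (AllPairs.map s<s (elements-increasing p))

∈-elements⁺ : ∀ {n} {p : Subset n} {i} → i ∈ₛ p → toℕ i ∈ elements p
∈-elements⁺ {p = true  ∷ _} Vec.here      = here refl
∈-elements⁺ {p = true  ∷ _} (Vec.there i∈) = there (∈-map⁺ suc (∈-elements⁺ i∈))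
∈-elements⁺ {p = false ∷ _} (Vec.there i∈) = ∈-map⁺ suc (∈-elements⁺ i∈)

∈-elements⁻ : ∀ {n} (p : Subset n) {x} → x ∈ elements p → ∃ λ i → toℕ i ≡ x × i ∈ₛ p
∈-suc-elements⁻ : ∀ {n b} {p : Subset n} {x} → x ∈ map suc (elements p) →
  ∃ λ i → toℕ i ≡ x × i ∈ₛ (b ∷ p)
∈-elements⁻ (true  ∷ _) (here refl) = fzero , refl , Vec.here
∈-elements⁻ (true  ∷ _) (there x∈) = ∈-suc-elements⁻ x∈
∈-elements⁻ (false ∷ _) x∈         = ∈-suc-elements⁻ x∈

∈-suc-elements⁻ {p = p} x∈ with ∈-map⁻ suc x∈
... | y , y∈ , refl with ∈-elements⁻ p y∈
... | i , refl , i∈ = fsuc i , refl , Vec.there i∈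

elements-< : ∀ {n} (p : Subset n) {x} → x ∈ elements p → x < n
elements-< {n} p x∈ with ∈-elements⁻ p x∈
... | i , i≡x , _ = subst (_< n) i≡x (toℕ<n i)

fromList : ∀ n → List ℕ → Subset n
fromList n xs = tabulate (λ i → does (toℕ i ∈? xs))

∈-fromList⁺ : ∀ {n xs} {i : Fin n} → toℕ i ∈ xs → i ∈ₛ fromList n xs
∈-fromList⁺ {xs = xs} {i} i∈ =
  lookup⇒[]= i _ (trans (lookup∘tabulate _ i) (dec-true (toℕ i ∈? xs) i∈))

∈-fromList⁻ : ∀ {n} xs {i : Fin n} → i ∈ₛ fromList n xs → toℕ i ∈ xs
∈-fromList⁻ xs {i} i∈ with toℕ i ∈? xs | lookup∘tabulate (λ j → does (toℕ j ∈? xs)) i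
... | yes i∈xs | _           = i∈xs
... | no  _    | lookup≡false = contradiction (trans (sym ([]=⇒lookup i∈)) lookup≡false) λ ()

elements-fromList : ∀ {n xs} → Increasing xs → All (_< n) xs → elements (fromList n xs) ≡ xs
elements-fromList {n} {xs} xs↗ xs<n = increasing-unique (elements-increasing (fromList n xs)) xs↗ ⊆xs ⊇xs
  where
  ⊆xs : ∀ {x} → x ∈ elements (fromList n xs) → x ∈ xs
  ⊆xs x∈ with ∈-elements⁻ (fromList n xs) x∈
  ... | i , i≡x , i∈ = subst (_∈ xs) i≡x (∈-fromList⁻ xs i∈)
  ⊇xs : ∀ {x} → x ∈ xs → x ∈ elements (fromList n xs)
  ⊇xs {x} x∈ = subst (_∈ elements (fromList n xs)) toℕ-i≡x
    (∈-elements⁺ (∈-fromList⁺ (subst (_∈ xs) (sym toℕ-i≡x) x∈)))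
    where
    toℕ-i≡x = toℕ-fromℕ< (All.lookup xs<n x∈)

∣fromList∣ : ∀ {n xs} → Increasing xs → All (_< n) xs → ∣ fromList n xs ∣ ≡ length xs
∣fromList∣ {n} {xs} xs↗ xs<n =
  trans (∣p∣≡length-elements (fromList n xs)) (cong length (elements-fromList xs↗ xs<n))

∈-elements⇒∈ : ∀ {n} (p : Subset n) {i} → toℕ i ∈ elements p → i ∈ₛ p
∈-elements⇒∈ p i∈ with ∈-elements⁻ p i∈
... | j , j≡i , j∈ = subst (_∈ₛ p) (toℕ-injective j≡i) j∈

fromList-elements : ∀ {n} (p : Subset n) → fromList n (elements p) ≡ p
fromList-elements p = ⊆-antisym (∈-elements⇒∈ p ∘ ∈-fromList⁻ (elements p)) (∈-fromList⁺ ∘ ∈-elements⁺)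

fromList-⊆ : ∀ {n} {p : Subset n} {xs} → All (_∈ elements p) xs → fromList n xs ⊆ₛ p
fromList-⊆ {p = p} {xs} xs⊆ i∈ = ∈-elements⇒∈ p (All.lookup xs⊆ (∈-fromList⁻ xs i∈))

elements-of-triple : ∀ {n} (p : Subset n) → ∣ p ∣ ≡ 3 →
  ∃ λ x → ∃ λ y → ∃ λ z → elements p ≡ x ∷ y ∷ z ∷ []
elements-of-triple p ∣p∣≡3 with elements p | ∣p∣≡length-elements p
... | x ∷ y ∷ z ∷ []    | _   = x , y , z , refl
... | []                | eq  = contradiction (trans (sym ∣p∣≡3) eq) λ ()
... | _ ∷ []            | eq  = contradiction (trans (sym ∣p∣≡3) eq) λ ()
... | _ ∷ _ ∷ []        | eq  = contradiction (trans (sym ∣p∣≡3) eq) λ ()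
... | _ ∷ _ ∷ _ ∷ _ ∷ _ | eq  = contradiction (trans (sym ∣p∣≡3) eq) λ ()

nth : List ℕ → ℕ → ℕ
nth []       _       = 0
nth (x ∷ _)  zero    = x
nth (_ ∷ xs) (suc i) = nth xs i

nth-∈ : ∀ xs {i} → i < length xs → nth xs i ∈ xs
nth-∈ (x ∷ xs) {zero}  _         = here refl
nth-∈ (x ∷ xs) {suc i} (s≤s i<n) = there (nth-∈ xs i<n)

nth-increasing : ∀ {xs i j} → Increasing xs → i < j → j < length xs → nth xs i < nth xs j
nth-increasing {x ∷ xs} {zero}  {suc j} (x< ∷ _)   _         (s≤s j<n) = All.lookup x< (nth-∈ xs j<n)
nth-increasing {x ∷ xs} {suc i} {suc j} (_ ∷ xs↗) (s≤s i<j) (s≤s j<n) = nth-increasing xs↗ i<j j<n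

⌊m/2⌋<⌊n/2⌋ : ∀ {m n} → m < n → ⌊ m /2⌋ ≢ ⌊ n /2⌋ → ⌊ m /2⌋ < ⌊ n /2⌋
⌊m/2⌋<⌊n/2⌋ m<n = ≤∧≢⇒< (⌊n/2⌋-mono (<⇒≤ m<n))

n<2*k⇒⌊n/2⌋<k : ∀ {n} k → n < 2 * k → ⌊ n /2⌋ < k
n<2*k⇒⌊n/2⌋<k {n} k n<2k = ≰⇒> λ k≤⌊n/2⌋ → <⇒≱ n<2k (begin
  2 * k               ≡⟨ cong (k +_) (+-identityʳ k) ⟩
  k + k               ≤⟨ +-mono-≤ k≤⌊n/2⌋ (≤-trans k≤⌊n/2⌋ (⌊n/2⌋≤⌈n/2⌉ n)) ⟩
  ⌊ n /2⌋ + ⌈ n /2⌉   ≡⟨ ⌊n/2⌋+⌈n/2⌉≡n n ⟩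
  n                   ∎)
  where open ≤-Reasoning

⌊a/2⌋≢⌊c/2⌋ : ∀ {a b c} → a < b → b < c → ⌊ a /2⌋ ≢ ⌊ c /2⌋
⌊a/2⌋≢⌊c/2⌋ a<b b<c = <⇒≢ (⌊n/2⌋-mono (<-≤-trans (s<s a<b) b<c))

-- For a ≠ b below 2 ^ k, δ k a b is the position of the highest bit in which a and b differ.
δ : ℕ → ℕ → ℕ → ℕ
δ zero    a b = 0
δ (suc k) a b with ⌊ a /2⌋ ≟ ⌊ b /2⌋
... | yes _ = 0
... | no  _ = suc (δ k ⌊ a /2⌋ ⌊ b /2⌋)

δ-≢ : ∀ {k a b} → ⌊ a /2⌋ ≢ ⌊ b /2⌋ → δ (suc k) a b ≡ suc (δ k ⌊ a /2⌋ ⌊ b /2⌋)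
δ-≢ {a = a} {b} a≢b with ⌊ a /2⌋ ≟ ⌊ b /2⌋
... | yes a≡b = contradiction a≡b a≢b
... | no  _   = refl

δ-< : ∀ k {a b} → a < b → b < 2 ^ k → δ k a b < k
δ-< zero    a<b b<1 = ⊥-elim (n≮0 (<-≤-trans a<b (s≤s⁻¹ b<1)))
δ-< (suc k) {a} {b} a<b b<2^k+1 with ⌊ a /2⌋ ≟ ⌊ b /2⌋
... | yes _   = z<s
... | no  a≢b = s<s (δ-< k (⌊m/2⌋<⌊n/2⌋ a<b a≢b) (n<2*k⇒⌊n/2⌋<k (2 ^ k) b<2^k+1))

δ-join : ∀ k {a b c} → a < b → b < c → c < 2 ^ k → δ k a c ≡ δ k a b ⊔ δ k b c
δ-join zero    _   b<c c<1 = ⊥-elim (n≮0 (<-≤-trans b<c (s≤s⁻¹ c<1)))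
δ-join (suc k) {a} {b} {c} a<b b<c c<2^k+1 with ⌊ a /2⌋ ≟ ⌊ b /2⌋ | ⌊ b /2⌋ ≟ ⌊ c /2⌋
... | yes a≡b | yes b≡c = contradiction (trans a≡b b≡c) (⌊a/2⌋≢⌊c/2⌋ a<b b<c)
... | yes a≡b | no  b≢c = trans (δ-≢ (b≢c ∘ trans (sym a≡b))) (cong (λ x → suc (δ k x ⌊ c /2⌋)) a≡b)
... | no  a≢b | yes b≡c = trans (δ-≢ (a≢b ∘ flip trans (sym b≡c))) (cong (λ x → suc (δ k ⌊ a /2⌋ x)) (sym b≡c))
... | no  a≢b | no  b≢c = trans (δ-≢ (⌊a/2⌋≢⌊c/2⌋ a<b b<c))
  (cong suc (δ-join k (⌊m/2⌋<⌊n/2⌋ a<b a≢b) (⌊m/2⌋<⌊n/2⌋ b<c b≢c) (n<2*k⇒⌊n/2⌋<k (2 ^ k) c<2^k+1)))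

δ-distinct : ∀ k {a b c} → a < b → b < c → c < 2 ^ k → δ k a b ≢ δ k b c
δ-distinct zero    _   b<c c<1 = ⊥-elim (n≮0 (<-≤-trans b<c (s≤s⁻¹ c<1)))
δ-distinct (suc k) {a} {b} {c} a<b b<c c<2^k+1 with ⌊ a /2⌋ ≟ ⌊ b /2⌋ | ⌊ b /2⌋ ≟ ⌊ c /2⌋
... | yes a≡b | yes b≡c = contradiction (trans a≡b b≡c) (⌊a/2⌋≢⌊c/2⌋ a<b b<c)
... | yes _   | no  _   = λ ()
... | no  _   | yes _   = λ ()
... | no  a≢b | no  b≢c =
  δ-distinct k (⌊m/2⌋<⌊n/2⌋ a<b a≢b) (⌊m/2⌋<⌊n/2⌋ b<c b≢c) (n<2*k⇒⌊n/2⌋<k (2 ^ k) c<2^k+1) ∘ suc-injective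

-- Abstract δ-systems

module _ {R : ℕ → ℕ → Set} (R-trans : ∀ {x y z} → R x y → R y z → R x z) (f : ℕ → ℕ) {n : ℕ}
         (R-step : ∀ {i} → suc i < n → R (f i) (f (suc i))) where

  steps⇒monotone : ∀ {i j} → i < j → j < n → R (f i) (f j)
  steps⇒monotone {i} {suc j} (s≤s i≤j) 1+j<n with m≤n⇒m<n∨m≡n i≤j
  ... | inj₁ i<j  = R-trans (steps⇒monotone i<j (<-trans (n<1+n j) 1+j<n)) (R-step 1+j<n)
  ... | inj₂ refl = R-step 1+j<n

module _ {f : ℕ → ℕ} {n : ℕ} where

  increasing-reflects : (∀ {i j} → i < j → j < n → f i < f j) →
    ∀ {i j} → i < n → j < n → f i < f j → i < j
  increasing-reflects f↗ {i} {j} i<n j<n fi<fj with <-cmp i j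
  ... | tri< i<j _ _ = i<j
  ... | tri≈ _ refl _ = contradiction fi<fj (<-irrefl refl)
  ... | tri> _ _ j<i = contradiction fi<fj (<-asym (f↗ j<i i<n))

  decreasing-reflects : (∀ {i j} → i < j → j < n → f j < f i) →
    ∀ {i j} → i < n → j < n → f i < f j → j < i
  decreasing-reflects f↘ {i} {j} i<n j<n fi<fj with <-cmp i j
  ... | tri< i<j _ _ = contradiction fi<fj (<-asym (f↘ i<j j<n))
  ... | tri≈ _ refl _ = contradiction fi<fj (<-irrefl refl)
  ... | tri> _ _ j<i = j<i

-- Δ p q stands for δ of the p-th and the q-th vertex of an increasing sequence of m vertices.
record DeltaSystem (m N : ℕ) : Set where
  field
    Δ          : ℕ → ℕ → ℕ
    Δ-join     : ∀ {p q u} → p < q → q < u → u < m → Δ p u ≡ Δ p q ⊔ Δ q u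
    Δ-distinct : ∀ {p q u} → p < q → q < u → u < m → Δ p q ≢ Δ q u
    Δ-<        : ∀ {p q} → p < q → q < m → Δ p q < N

module _ {m N : ℕ} (S : DeltaSystem m N) where

  open DeltaSystem S

  record Realised (x y z : ℕ) : Set where
    constructor realised
    field
      {p q u v} : ℕ
      p<q : p < q
      q<u : q < u
      u<v : u < v
      v<m : v < m
      shape : (Δ p q ≡ x × Δ q u ≡ y × Δ u v ≡ z) ⊎ (Δ p q ≡ z × Δ q u ≡ y × Δ u v ≡ x)

  record RealisedSet (n : ℕ) : Set where
    field
      values     : List ℕ
      increasing : Increasing values
      size       : length values ≡ n
      bounded    : All (_< N) values
      realises   : ∀ {x y z} → x ∈ values → y ∈ values → z ∈ values → x < y → y < z → Realised x y z

  record Chain (n : ℕ) : Set where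
    field
      vertex      : ℕ → ℕ
      vertex-step : ∀ {i} → i < n → vertex i < vertex (suc i)
      vertex-last : vertex n < m

    step : ℕ → ℕ
    step i = Δ (vertex i) (vertex (suc i))

    vertex-mono : ∀ {i j} → i < j → j ≤ n → vertex i < vertex j
    vertex-mono i<j j≤n = steps⇒monotone {R = _<_} <-trans vertex (vertex-step ∘ s≤s⁻¹) i<j (s≤s j≤n)

    vertex-≤-last : ∀ {j} → j ≤ n → vertex j ≤ vertex n
    vertex-≤-last j≤n with m≤n⇒m<n∨m≡n j≤n
    ... | inj₁ j<n  = <⇒≤ (vertex-mono j<n ≤-refl)
    ... | inj₂ refl = ≤-refl

    vertex-< : ∀ {j} → j ≤ n → vertex j < m
    vertex-< j≤n = ≤-<-trans (vertex-≤-last j≤n) vertex-last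

    step-< : ∀ {i} → i < n → step i < N
    step-< i<n = Δ-< (vertex-step i<n) (vertex-< i<n)

    Rising Falling : Set
    Rising  = ∀ {i} → suc i < n → step i < step (suc i)
    Falling = ∀ {i} → suc i < n → step (suc i) < step i

  module _ {n : ℕ} (c : Chain n) where

    open Chain c

    Δ-rising : Rising → ∀ {p q} → p ≤ q → q < n → Δ (vertex p) (vertex (suc q)) ≡ step q
    Δ-rising c↗ {q = zero}  z≤n _ = refl
    Δ-rising c↗ {p} {suc q} p≤1+q 1+q<n with m≤n⇒m<n∨m≡n p≤1+q
    ... | inj₂ refl      = refl
    ... | inj₁ (s≤s p≤q) = begin
      Δ (vertex p) (vertex (2 + q))
        ≡⟨ Δ-join (vertex-mono (s≤s p≤q) (<⇒≤ 1+q<n)) (vertex-step 1+q<n) (vertex-< 1+q<n) ⟩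
      Δ (vertex p) (vertex (suc q)) ⊔ step (suc q)
        ≡⟨ cong (_⊔ step (suc q)) (Δ-rising c↗ p≤q (<-trans (n<1+n q) 1+q<n)) ⟩
      step q ⊔ step (suc q)
        ≡⟨ m≤n⇒m⊔n≡n (<⇒≤ (c↗ 1+q<n)) ⟩
      step (suc q)
        ∎
      where open ≡-Reasoning

    Δ-falling : Falling → ∀ {p q} → p < q → q ≤ n → Δ (vertex p) (vertex q) ≡ step p
    Δ-falling c↘ {p} {suc q} (s≤s p≤q) 1+q≤n with m≤n⇒m<n∨m≡n p≤q
    ... | inj₂ refl = refl
    ... | inj₁ p<q  = begin
      Δ (vertex p) (vertex (suc q))
        ≡⟨ Δ-join (vertex-mono p<q (<⇒≤ 1+q≤n)) (vertex-step 1+q≤n) (vertex-< 1+q≤n) ⟩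
      Δ (vertex p) (vertex q) ⊔ step q
        ≡⟨ cong (_⊔ step q) (Δ-falling c↘ p<q (<⇒≤ 1+q≤n)) ⟩
      step p ⊔ step q
        ≡⟨ m≥n⇒m⊔n≡m (<⇒≤ (steps⇒monotone {R = flip _<_} (flip <-trans) step c↘ p<q 1+q≤n)) ⟩
      step p
        ∎
      where open ≡-Reasoning

    rising⇒realisedSet : Rising → RealisedSet n
    rising⇒realisedSet c↗ = record
      { values     = applyUpTo step n
      ; increasing = AllPairs.applyUpTo⁺₁ step n step-mono
      ; size       = length-applyUpTo step n
      ; bounded    = All.applyUpTo⁺₁ step n step-<
      ; realises   = realises
      }
      where
      step-mono : ∀ {i j} → i < j → j < n → step i < step j
      step-mono = steps⇒monotone {R = _<_} <-trans step c↗
      realises : ∀ {x y z} → x ∈ applyUpTo step n → y ∈ applyUpTo step n → z ∈ applyUpTo step n →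
                 x < y → y < z → Realised x y z
      realises x∈ y∈ z∈ x<y y<z
        with ∈-applyUpTo⁻ step x∈ | ∈-applyUpTo⁻ step y∈ | ∈-applyUpTo⁻ step z∈
      ... | i , i<n , refl | j , j<n , refl | l , l<n , refl =
        realised (vertex-step i<n) (vertex-mono (s<s i<j) j<n) (vertex-mono (s<s j<l) l<n) (vertex-< l<n)
                 (inj₁ (refl , Δ-rising c↗ i<j j<n , Δ-rising c↗ j<l l<n))
        where
        i<j = increasing-reflects step-mono i<n j<n x<y
        j<l = increasing-reflects step-mono j<n l<n y<z

    falling⇒realisedSet : Falling → RealisedSet n
    falling⇒realisedSet c↘ = record
      { values     = applyDownFrom step n
      ; increasing = AllPairs.applyDownFrom⁺₁ step n (λ j<i i<n → step-anti j<i i<n)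
      ; size       = length-applyDownFrom step n
      ; bounded    = All.applyDownFrom⁺₁ step n step-<
      ; realises   = realises
      }
      where
      step-anti : ∀ {i j} → i < j → j < n → step j < step i
      step-anti = steps⇒monotone {R = flip _<_} (flip <-trans) step c↘
      realises : ∀ {x y z} → x ∈ applyDownFrom step n → y ∈ applyDownFrom step n → z ∈ applyDownFrom step n →
                 x < y → y < z → Realised x y z
      realises x∈ y∈ z∈ x<y y<z
        with ∈-applyDownFrom⁻ step x∈ | ∈-applyDownFrom⁻ step y∈ | ∈-applyDownFrom⁻ step z∈
      ... | i , i<n , refl | j , j<n , refl | l , l<n , refl =
        realised (vertex-mono l<j (<⇒≤ j<n)) (vertex-mono j<i (<⇒≤ i<n)) (vertex-step i<n) (vertex-< i<n)
                 (inj₂ (Δ-falling c↘ l<j (<⇒≤ j<n) , Δ-falling c↘ j<i (<⇒≤ i<n) , refl))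
        where
        j<i = decreasing-reflects step-anti i<n j<n x<y
        l<j = decreasing-reflects step-anti j<n l<n y<z

  PeakFree RisingValleyFree FallingValleyFree : Set
  PeakFree          = ∀ {p q u v} → p < q → q < u → u < v → v < m →
                      ¬ (Δ p q < Δ q u × Δ u v < Δ q u)
  RisingValleyFree  = ∀ {p q u v} → p < q → q < u → u < v → v < m →
                      ¬ (Δ q u < Δ p q × Δ q u < Δ u v × Δ p q < Δ u v)
  FallingValleyFree = ∀ {p q u v} → p < q → q < u → u < v → v < m →
                      ¬ (Δ q u < Δ p q × Δ q u < Δ u v × Δ u v < Δ p q)

  gap : ℕ → ℕ
  gap j = Δ j (suc j)

  segment : ∀ i n → n + i < m → Chain n
  segment i n n+i<m = record { vertex = _+ i ; vertex-step = λ _ → n<1+n _ ; vertex-last = n+i<m }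

  module _ (peakFree : PeakFree) where

    rise-persists : ∀ {i j} → gap i < gap (suc i) → i ≤ j → 2 + j < m → gap j < gap (suc j)
    rise-persists {i} {j} rise i≤j 2+j<m with m≤n⇒m<n∨m≡n i≤j
    ... | inj₂ refl = rise
    rise-persists {j = suc j} rise _ 3+j<m | inj₁ (s≤s i≤j) =
      ≤∧≢⇒< (≮⇒≥ (λ fall → peakFree (n<1+n _) (n<1+n _) (n<1+n _) 3+j<m (previous , fall)))
            (Δ-distinct (n<1+n _) (n<1+n _) 3+j<m)
      where
      previous = rise-persists rise i≤j (<-trans (n<1+n _) 3+j<m)

    -- Without peaks a rise persists, so the gaps either rise from gap (n ∸ 1) on or fall up to gap n.
    peakFree⇒realisedSet : ∀ {n} → 0 < n → n + n < m → RealisedSet n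
    peakFree⇒realisedSet {suc k} _ 2n<m = realisedSet
      where
      2+k<m : 2 + k < m
      2+k<m = ≤-<-trans (s≤s (m≤n+m (suc k) k)) 2n<m
      realisedSet : RealisedSet (suc k)
      realisedSet with <-cmp (gap k) (gap (suc k))
      ... | tri< rise _ _ = rising⇒realisedSet (segment k (suc k) (≤-<-trans (+-monoʳ-≤ (suc k) (n≤1+n k)) 2n<m))
          λ {i} 1+i<1+k → rise-persists rise (m≤n+m k i)
            (≤-<-trans (+-monoˡ-≤ k 1+i<1+k) (<-trans (+-monoʳ-< (suc k) (n<1+n k)) 2n<m))
      ... | tri≈ _ same _ = contradiction same (Δ-distinct (n<1+n k) (n<1+n _) 2+k<m)
      ... | tri> _ _ fall = falling⇒realisedSet (segment 0 (suc k) (≤-<-trans (+-monoʳ-≤ (suc k) z≤n) 2n<m))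
          λ {i} 1+i<1+k → subst₂ (λ a b → gap a < gap b) (sym (+-identityʳ (suc i))) (sym (+-identityʳ i))
            (≤∧≢⇒< (≮⇒≥ λ rise → <-asym fall (rise-persists rise (s≤s⁻¹ (<⇒≤ 1+i<1+k)) 2+k<m))
                   (Δ-distinct (n<1+n i) (n<1+n _) (≤-<-trans (≤-trans 1+i<1+k (n≤1+n _)) 2+k<m) ∘ sym))

  Δ-monoˡ : ∀ {l u v} → l ≤ u → u < v → v < m → Δ u v ≤ Δ l v
  Δ-monoˡ {l} {u} {v} l≤u u<v v<m with m≤n⇒m<n∨m≡n l≤u
  ... | inj₂ refl = ≤-refl
  ... | inj₁ l<u  = subst (Δ u v ≤_) (sym (Δ-join l<u u<v v<m)) (m≤n⊔m (Δ l u) (Δ u v))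

  Δ-monoʳ : ∀ {u v h} → u < v → v ≤ h → h < m → Δ u v ≤ Δ u h
  Δ-monoʳ {u} {v} {h} u<v v≤h h<m with m≤n⇒m<n∨m≡n v≤h
  ... | inj₂ refl = ≤-refl
  ... | inj₁ v<h  = subst (Δ u v ≤_) (sym (Δ-join u<v v<h h<m)) (m≤m⊔n (Δ u v) (Δ v h))

  Δ-mono : ∀ {lo u v hi} → lo ≤ u → u < v → v ≤ hi → hi < m → Δ u v ≤ Δ lo hi
  Δ-mono lo≤u u<v v≤hi hi<m =
    ≤-trans (Δ-monoˡ lo≤u u<v (≤-<-trans v≤hi hi<m)) (Δ-monoʳ (≤-<-trans lo≤u u<v) v≤hi hi<m)

  Δ-attained : ∀ {lo hi} → lo < hi → hi < m → ∃ λ t → lo ≤ t × t < hi × gap t ≡ Δ lo hi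
  Δ-attained {lo} {suc h} (s≤s lo≤h) 1+h<m with m≤n⇒m<n∨m≡n lo≤h
  ... | inj₂ refl = lo , ≤-refl , ≤-refl , refl
  ... | inj₁ lo<h with Δ lo h ≤? gap h
  ...   | yes ≤gap = h , lo≤h , ≤-refl , trans (sym (m≤n⇒m⊔n≡n ≤gap)) (sym (Δ-join lo<h ≤-refl 1+h<m))
  ...   | no  ≰gap with Δ-attained lo<h (<-trans (n<1+n h) 1+h<m)
  ...     | t , lo≤t , t<h , gap-t = t , lo≤t , <-trans t<h (n<1+n h) ,
            trans gap-t (trans (sym (m≥n⇒m⊔n≡m (<⇒≤ (≰⇒> ≰gap)))) (sym (Δ-join lo<h ≤-refl 1+h<m)))

  module Split {lo t hi : ℕ} (lo≤t : lo ≤ t) (t<hi : t < hi) (hi<m : hi < m) (gap-t : gap t ≡ Δ lo hi) where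

    Δ-across : ∀ {u v} → lo ≤ u → u ≤ t → suc t ≤ v → v ≤ hi → Δ u v ≡ Δ lo hi
    Δ-across lo≤u u≤t t<v v≤hi = ≤-antisym (Δ-mono lo≤u (≤-<-trans u≤t t<v) v≤hi hi<m)
      (subst (_≤ Δ _ _) gap-t (Δ-mono u≤t ≤-refl t<v (≤-<-trans v≤hi hi<m)))

    Δ-left : ∀ {u v} → lo ≤ u → u < v → v ≤ t → Δ u v < Δ lo hi
    Δ-left lo≤u u<v v≤t = ≤∧≢⇒< (Δ-mono lo≤u u<v (≤-trans v≤t (<⇒≤ t<hi)) hi<m)
      λ same → Δ-distinct u<v (s≤s v≤t) (≤-<-trans t<hi hi<m)
        (trans same (sym (Δ-across (≤-trans lo≤u (<⇒≤ u<v)) v≤t ≤-refl t<hi)))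

    Δ-right : ∀ {u v} → suc t ≤ u → u < v → v ≤ hi → Δ u v < Δ lo hi
    Δ-right t<u u<v v≤hi = ≤∧≢⇒< (Δ-mono (≤-trans lo≤t (≤-trans (n≤1+n t) t<u)) u<v v≤hi hi<m)
      λ same → Δ-distinct t<u u<v (≤-<-trans v≤hi hi<m)
        (trans (Δ-across lo≤t ≤-refl t<u (≤-trans (<⇒≤ u<v) v≤hi)) (sym same))

  -- Split [lo, hi] at a gap t carrying the maximum Δ lo hi. If [lo, t + 1] has n + 1 points, its gaps rise,
  -- since a fall would form a rising valley with the maximum; otherwise t heads a falling chain that
  -- continues inside [t + 1, hi].
  module _ (valleyFree : RisingValleyFree) {n hi : ℕ} (0<n : 0 < n) (hi<m : hi < m) where

    record FallingChain (k lo : ℕ) : Set where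
      field
        chain   : Chain k
        start   : lo ≤ Chain.vertex chain 0
        end     : Chain.vertex chain k ≤ hi
        falling : Chain.Falling chain

    long-left⇒realisedSet : ∀ {lo t} → lo ≤ t → t < hi → gap t ≡ Δ lo hi → lo + n ≤ suc t → RealisedSet n
    long-left⇒realisedSet {lo} {t} lo≤t t<hi gap-t long = rising⇒realisedSet (segment lo n n+lo<m) rises
      where
      open Split lo≤t t<hi hi<m gap-t
      n+lo≤1+t : n + lo ≤ suc t
      n+lo≤1+t = subst (_≤ suc t) (+-comm lo n) long
      n+lo<m : n + lo < m
      n+lo<m = ≤-<-trans n+lo≤1+t (≤-<-trans t<hi hi<m)
      rises : ∀ {i} → suc i < n → gap (i + lo) < gap (suc i + lo)
      rises {i} 2+i≤n with m≤n⇒m<n∨m≡n (≤-trans (+-monoˡ-≤ lo 2+i≤n) n+lo≤1+t)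
      ... | inj₂ 2+i+lo≡1+t with suc-injective 2+i+lo≡1+t
      ...   | refl = subst (gap (i + lo) <_) (sym gap-t) (Δ-left (m≤n+m lo i) ≤-refl ≤-refl)
      rises {i} 2+i≤n | inj₁ (s≤s 2+i+lo≤t) =
        ≤∧≢⇒< (≮⇒≥ λ fall → valleyFree ≤-refl ≤-refl (s≤s 2+i+lo≤t) (≤-<-trans t<hi hi<m)
                 (fall , below-max (Δ-left (m≤n+m lo (suc i)) ≤-refl 2+i+lo≤t)
                       , below-max (Δ-left (m≤n+m lo i) ≤-refl (≤-trans (n≤1+n _) 2+i+lo≤t))))
              (Δ-distinct ≤-refl ≤-refl (≤-<-trans 2+i+lo≤t (<-trans t<hi hi<m)))
        where
        below-max : ∀ {x} → x < Δ lo hi → x < Δ (2 + i + lo) (suc t)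
        below-max = subst (_ <_) (sym (Δ-across (m≤n+m lo (2 + i)) 2+i+lo≤t ≤-refl t<hi))

    prepend : ∀ {k lo t} → lo ≤ t → t < hi → gap t ≡ Δ lo hi → FallingChain k (suc t) → FallingChain (suc k) lo
    prepend {k} {lo} {t} lo≤t t<hi gap-t fc = record
      { chain   = record { vertex = vertex′ ; vertex-step = vertex′-step ; vertex-last = ≤-<-trans end hi<m }
      ; start   = lo≤t
      ; end     = end
      ; falling = falling′
      }
      where
      open Split lo≤t t<hi hi<m gap-t
      open FallingChain fc
      open Chain chain
      vertex′ : ℕ → ℕ
      vertex′ zero    = t
      vertex′ (suc i) = vertex i
      vertex′-step : ∀ {i} → i < suc k → vertex′ i < vertex′ (suc i)
      vertex′-step {zero}  _         = start
      vertex′-step {suc i} (s≤s i<k) = vertex-step i<k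
      vertex-≤hi : ∀ {j} → j ≤ k → vertex j ≤ hi
      vertex-≤hi j≤k = ≤-trans (vertex-≤-last j≤k) end
      falling′ : ∀ {i} → suc i < suc k →
                 Δ (vertex′ (suc i)) (vertex′ (2 + i)) < Δ (vertex′ i) (vertex′ (suc i))
      falling′ {zero}  (s≤s 0<k)   = subst (step 0 <_) (sym (Δ-across lo≤t ≤-refl start (vertex-≤hi z≤n)))
                                       (Δ-right start (vertex-step 0<k) (vertex-≤hi 0<k))
      falling′ {suc i} (s≤s 1+i<k) = falling 1+i<k

    falling-or-realised : ∀ k lo → lo + k * n ≤ hi → RealisedSet n ⊎ FallingChain k lo
    falling-or-realised zero lo lo+0≤hi = inj₂ (record
      { chain   = record { vertex = λ _ → lo ; vertex-step = λ () ; vertex-last = ≤-<-trans lo≤hi hi<m }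
      ; start   = ≤-refl
      ; end     = lo≤hi
      ; falling = λ ()
      })
      where lo≤hi = ≤-trans (m≤m+n lo 0) lo+0≤hi
    falling-or-realised (suc k) lo room
      with Δ-attained (<-≤-trans (m<m+n lo (<-≤-trans 0<n (m≤m+n n (k * n)))) room) hi<m
    ... | t , lo≤t , t<hi , gap-t with lo + n ≤? suc t
    ...   | yes long = inj₁ (long-left⇒realisedSet lo≤t t<hi gap-t long)
    ...   | no  short with falling-or-realised k (suc t) (≤-trans (+-monoˡ-≤ (k * n) (<⇒≤ (≰⇒> short)))
                                                          (subst (_≤ hi) (sym (+-assoc lo n (k * n))) room))
    ...     | inj₁ realisedSet = inj₁ realisedSet
    ...     | inj₂ fc          = inj₂ (prepend lo≤t t<hi gap-t fc)

  risingValleyFree⇒realisedSet : RisingValleyFree → ∀ {n} → 0 < n → n * n < m → RealisedSet n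
  risingValleyFree⇒realisedSet valleyFree {n} 0<n n²<m with falling-or-realised valleyFree 0<n n²<m n 0 ≤-refl
  ... | inj₁ realisedSet = realisedSet
  ... | inj₂ fc          = falling⇒realisedSet chain falling
    where open FallingChain fc

module _ {m N : ℕ} (S : DeltaSystem m N) where

  open DeltaSystem S

  mirror : ℕ → ℕ
  mirror p = m ∸ suc p

  mirror-< : ∀ {p q} → p < q → q < m → mirror q < mirror p
  mirror-< p<q q<m = ∸-monoʳ-< (s<s p<q) q<m

  mirror-bound : ∀ {p} → p < m → mirror p < m
  mirror-bound p<m = ∸-monoʳ-< {o = 0} z<s p<m

  reverse : DeltaSystem m N
  reverse = record
    { Δ          = λ p q → Δ (mirror q) (mirror p)
    ; Δ-join     = λ {p} {q} {u} p<q q<u u<m → trans (Δ-join (mirror-< q<u u<m) (mirror-< p<q (<-trans q<u u<m))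
                     (mirror-bound (<-trans p<q (<-trans q<u u<m)))) (⊔-comm (Δ (mirror u) (mirror q)) _)
    ; Δ-distinct = λ p<q q<u u<m → Δ-distinct (mirror-< q<u u<m) (mirror-< p<q (<-trans q<u u<m))
                     (mirror-bound (<-trans p<q (<-trans q<u u<m))) ∘ sym
    ; Δ-<        = λ p<q q<m → Δ-< (mirror-< p<q q<m) (mirror-bound (<-trans p<q q<m))
    }

  reverse-risingValleyFree : FallingValleyFree S → RisingValleyFree reverse
  reverse-risingValleyFree valleyFree p<q q<u u<v v<m (a , b , c) =
    valleyFree (mirror-< u<v v<m) (mirror-< q<u u<m) (mirror-< p<q q<m) (mirror-bound p<m) (b , a , c)
    where
    u<m = <-trans u<v v<m
    q<m = <-trans q<u u<m
    p<m = <-trans p<q q<m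

  realisedSet-reverse : ∀ {n} → RealisedSet reverse n → RealisedSet S n
  realisedSet-reverse R = record
    { values = values ; increasing = increasing ; size = size ; bounded = bounded
    ; realises = λ x∈ y∈ z∈ x<y y<z → unmirror (realises x∈ y∈ z∈ x<y y<z) }
    where
    open RealisedSet R
    unmirror : ∀ {x y z} → Realised reverse x y z → Realised S x y z
    unmirror {x} {y} {z} (realised p<q q<u u<v v<m shape) =
      realised (mirror-< u<v v<m) (mirror-< q<u u<m) (mirror-< p<q q<m) (mirror-bound p<m) (reflect shape)
      where
      u<m = <-trans u<v v<m
      q<m = <-trans q<u u<m
      p<m = <-trans p<q q<m
      reflect : ∀ {a b c} → (a ≡ x × b ≡ y × c ≡ z) ⊎ (a ≡ z × b ≡ y × c ≡ x) →
                (c ≡ x × b ≡ y × a ≡ z) ⊎ (c ≡ z × b ≡ y × a ≡ x)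
      reflect (inj₁ (a , b , c)) = inj₂ (c , b , a)
      reflect (inj₂ (a , b , c)) = inj₁ (c , b , a)

realisedSet : ∀ {m N n} (S : DeltaSystem m N) → 0 < n → n + n < m → n * n < m →
  PeakFree S ⊎ RisingValleyFree S ⊎ FallingValleyFree S → RealisedSet S n
realisedSet S 0<n 2n<m n²<m (inj₁ peakFree) = peakFree⇒realisedSet S peakFree 0<n 2n<m
realisedSet S 0<n 2n<m n²<m (inj₂ (inj₁ valleyFree)) = risingValleyFree⇒realisedSet S valleyFree 0<n n²<m
realisedSet S 0<n 2n<m n²<m (inj₂ (inj₂ valleyFree)) = realisedSet-reverse S
  (risingValleyFree⇒realisedSet (reverse S) (reverse-risingValleyFree S valleyFree) 0<n n²<m)

interval : ℕ → ℕ → List ℕ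
interval lo k = applyUpTo (lo +_) k

interval-increasing : ∀ lo k → Increasing (interval lo k)
interval-increasing lo k = AllPairs.applyUpTo⁺₁ (lo +_) k (λ i<j _ → +-monoʳ-< lo i<j)

∈-interval⁻ : ∀ {lo k x} → x ∈ interval lo k → lo ≤ x × x < lo + k
∈-interval⁻ {lo} x∈ with ∈-applyUpTo⁻ (lo +_) x∈
... | i , i<k , refl = m≤m+n lo i , +-monoʳ-< lo i<k

interval-< : ∀ lo k {n} → lo + k ≤ n → All (_< n) (interval lo k)
interval-< lo k lo+k≤n = All.tabulate λ x∈ → <-≤-trans (proj₂ (∈-interval⁻ x∈)) lo+k≤n

∣fromList-interval∣ : ∀ {lo k n} → lo + k ≤ n → ∣ fromList n (interval lo k) ∣ ≡ k
∣fromList-interval∣ {lo} {k} lo+k≤n =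
  trans (∣fromList∣ (interval-increasing lo k) (interval-< lo k lo+k≤n)) (length-applyUpTo (lo +_) k)

record ThreeWayDisjoint (r s : ℕ) : Set where
  field
    A B C     : Subset r
    ∣A∣≡s     : ∣ A ∣ ≡ s
    ∣B∣≡s     : ∣ B ∣ ≡ s
    ∣C∣≡s     : ∣ C ∣ ≡ s
    no-common : ∀ c → ¬ c ∈ₛ A ⊎ ¬ c ∈ₛ B ⊎ ¬ c ∈ₛ C

-- A = [0, s), B = [r − s, r) and C = [0, min (r − s) s) ∪ [s, s + (s ∸ (r − s))): a common colour would
-- lie in [r − s, s), which C skips, and C fits below r because 3s ≤ 2r.
threeWayDisjoint : ∀ {r s} → 3 * s ≤ 2 * r → ThreeWayDisjoint r s
threeWayDisjoint {r} {s} 3s≤2r = record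
  { A         = fromList r (interval 0 s)
  ; B         = fromList r (interval d s)
  ; C         = fromList r lowHigh
  ; ∣A∣≡s     = ∣fromList-interval∣ s≤r
  ; ∣B∣≡s     = ∣fromList-interval∣ (≤-reflexive d+s≡r)
  ; ∣C∣≡s     = begin
      ∣ fromList r lowHigh ∣                                   ≡⟨ ∣fromList∣ lowHigh-increasing lowHigh-< ⟩
      length lowHigh                                           ≡⟨ length-++ (interval 0 (d ⊓ s)) ⟩
      length (interval 0 (d ⊓ s)) + length (interval s (s ∸ d)) ≡⟨ cong₂ _+_ (length-applyUpTo _ (d ⊓ s))
                                                                             (length-applyUpTo _ (s ∸ d)) ⟩
      d ⊓ s + (s ∸ d)                                          ≡⟨ m⊓n+n∸m≡n d s ⟩
      s                                                        ∎
  ; no-common = no-common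
  }
  where
  open ≡-Reasoning
  s≤r : s ≤ r
  s≤r = *-cancelˡ-≤ 3 (≤-trans 3s≤2r (*-monoˡ-≤ r (n≤1+n 2)))
  d = r ∸ s
  d+s≡r : d + s ≡ r
  d+s≡r = m∸n+n≡m s≤r
  s∸d≤d : s ∸ d ≤ d
  s∸d≤d = subst (s ∸ d ≤_) (+-identityʳ d) (m≤n+o⇒m∸n≤o s d (+-cancelʳ-≤ (2 * s) s (2 * d)
            (subst (3 * s ≤_) (trans (cong (2 *_) (sym d+s≡r)) (*-distribˡ-+ 2 d s)) 3s≤2r)))
  lowHigh : List ℕ
  lowHigh = interval 0 (d ⊓ s) ++ interval s (s ∸ d)
  lowHigh-increasing : Increasing lowHigh
  lowHigh-increasing = AllPairs.++⁺ (interval-increasing 0 (d ⊓ s)) (interval-increasing s (s ∸ d))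
    (All.tabulate λ x∈ → All.tabulate λ y∈ →
      <-≤-trans (proj₂ (∈-interval⁻ x∈)) (≤-trans (m⊓n≤n d s) (proj₁ (∈-interval⁻ y∈))))
  lowHigh-< : All (_< r) lowHigh
  lowHigh-< = All.++⁺ (interval-< 0 (d ⊓ s) (≤-trans (m⊓n≤n d s) s≤r))
                      (interval-< s (s ∸ d) (≤-trans (+-monoʳ-≤ s s∸d≤d) (≤-reflexive (trans (+-comm s d) d+s≡r))))
  no-common : ∀ c → ¬ c ∈ₛ fromList r (interval 0 s) ⊎ ¬ c ∈ₛ fromList r (interval d s) ⊎ ¬ c ∈ₛ fromList r lowHigh
  no-common c with c ∈ₛ? fromList r (interval 0 s) | c ∈ₛ? fromList r (interval d s)
  ... | no  c∉A | _       = inj₁ c∉A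
  ... | yes _   | no  c∉B = inj₂ (inj₁ c∉B)
  ... | yes c∈A | yes c∈B = inj₂ (inj₂ λ c∈C → case-split (∈-++⁻ (interval 0 (d ⊓ s)) (∈-fromList⁻ lowHigh c∈C)))
    where
    c<s = proj₂ (∈-interval⁻ (∈-fromList⁻ (interval 0 s) c∈A))
    d≤c = proj₁ (∈-interval⁻ (∈-fromList⁻ (interval d s) c∈B))
    case-split : toℕ c ∈ interval 0 (d ⊓ s) ⊎ toℕ c ∈ interval s (s ∸ d) → ⊥
    case-split (inj₁ c∈low)  = <⇒≱ (<-≤-trans (proj₂ (∈-interval⁻ c∈low)) (m⊓n≤m d s)) d≤c
    case-split (inj₂ c∈high) = <⇒≱ c<s (proj₁ (∈-interval⁻ c∈high))

-- The stepped-up colouring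

module SteppingUp {N r s : ℕ} (χ₃ : Subset N → Subset r) (χ₃-valid : IsRSColoring 3 N r s χ₃)
                  (T : ThreeWayDisjoint r s) where

  open ThreeWayDisjoint T

  -- The fallback A is only reached off genuine triangles, where it merely keeps the size s.
  triangleColour : ℕ → ℕ → ℕ → Subset r
  triangleColour x y z with x <? y ×-dec y <? z ×-dec z <? N
  ... | yes _ = χ₃ (fromList N (x ∷ y ∷ z ∷ []))
  ... | no  _ = A

  ∣triangleColour∣ : ∀ x y z → ∣ triangleColour x y z ∣ ≡ s
  ∣triangleColour∣ x y z with x <? y ×-dec y <? z ×-dec z <? N
  ... | yes (x<y , y<z , z<N) = χ₃-valid _
          (∣fromList∣ (increasing-triple x<y y<z) (<-trans x<y (<-trans y<z z<N) ∷ <-trans y<z z<N ∷ z<N ∷ []))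
  ... | no  _ = ∣A∣≡s

  triangleColour-≡ : ∀ {x y z} → x < y → y < z → z < N → triangleColour x y z ≡ χ₃ (fromList N (x ∷ y ∷ z ∷ []))
  triangleColour-≡ {x} {y} {z} x<y y<z z<N
    rewrite proj₂ (dec-yes (x <? y ×-dec y <? z ×-dec z <? N) (x<y , y<z , z<N)) = refl

  colourBy : ∀ {x y z} → Dec (x < y) → Dec (y < z) → Dec (x ≤ z) → Subset r
  colourBy {x} {y} {z} (yes _) (yes _) _       = triangleColour x y z
  colourBy {x} {y} {z} (no  _) (no  _) _       = triangleColour z y x
  colourBy             (yes _) (no  _) _       = A
  colourBy             (no  _) (yes _) (yes _) = B
  colourBy             (no  _) (yes _) (no  _) = C

  patternColour : ℕ → ℕ → ℕ → Subset r
  patternColour x y z = colourBy (x <? y) (y <? z) (x ≤? z)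

  ∣patternColour∣ : ∀ x y z → ∣ patternColour x y z ∣ ≡ s
  ∣patternColour∣ x y z = ∣colourBy∣ (x <? y) (y <? z) (x ≤? z)
    where
    ∣colourBy∣ : (x<y? : Dec (x < y)) (y<z? : Dec (y < z)) (x≤z? : Dec (x ≤ z)) → ∣ colourBy x<y? y<z? x≤z? ∣ ≡ s
    ∣colourBy∣ (yes _) (yes _) _       = ∣triangleColour∣ x y z
    ∣colourBy∣ (no  _) (no  _) _       = ∣triangleColour∣ z y x
    ∣colourBy∣ (yes _) (no  _) _       = ∣A∣≡s
    ∣colourBy∣ (no  _) (yes _) (yes _) = ∣B∣≡s
    ∣colourBy∣ (no  _) (yes _) (no  _) = ∣C∣≡s

  module _ {x y z : ℕ} where

    patternColour-rising : x < y → y < z → patternColour x y z ≡ triangleColour x y z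
    patternColour-rising x<y y<z = by (x <? y) (y <? z) (x ≤? z)
      where
      by : (x<y? : Dec (x < y)) (y<z? : Dec (y < z)) (x≤z? : Dec (x ≤ z)) →
           colourBy x<y? y<z? x≤z? ≡ triangleColour x y z
      by (yes _)   (yes _)   _ = refl
      by (no  x≮y) _         _ = contradiction x<y x≮y
      by (yes _)   (no  y≮z) _ = contradiction y<z y≮z

    patternColour-falling : y < x → z < y → patternColour x y z ≡ triangleColour z y x
    patternColour-falling y<x z<y = by (x <? y) (y <? z) (x ≤? z)
      where
      by : (x<y? : Dec (x < y)) (y<z? : Dec (y < z)) (x≤z? : Dec (x ≤ z)) →
           colourBy x<y? y<z? x≤z? ≡ triangleColour z y x
      by (no  _)   (no  _)   _ = refl
      by (yes x<y) _         _ = contradiction x<y (<-asym y<x)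
      by (no  _)   (yes y<z) _ = contradiction y<z (<-asym z<y)

    patternColour-peak : x < y → z < y → patternColour x y z ≡ A
    patternColour-peak x<y z<y = by (x <? y) (y <? z) (x ≤? z)
      where
      by : (x<y? : Dec (x < y)) (y<z? : Dec (y < z)) (x≤z? : Dec (x ≤ z)) →
           colourBy x<y? y<z? x≤z? ≡ A
      by (yes _)   (no  _)   _ = refl
      by (no  x≮y) _         _ = contradiction x<y x≮y
      by (yes _)   (yes y<z) _ = contradiction y<z (<-asym z<y)

    patternColour-risingValley : y < x → y < z → x < z → patternColour x y z ≡ B
    patternColour-risingValley y<x y<z x<z = by (x <? y) (y <? z) (x ≤? z)
      where
      by : (x<y? : Dec (x < y)) (y<z? : Dec (y < z)) (x≤z? : Dec (x ≤ z)) →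
           colourBy x<y? y<z? x≤z? ≡ B
      by (no  _)   (yes _)   (yes _)   = refl
      by (yes x<y) _         _         = contradiction x<y (<-asym y<x)
      by (no  _)   (no  y≮z) _         = contradiction y<z y≮z
      by (no  _)   (yes _)   (no  x≰z) = contradiction (<⇒≤ x<z) x≰z

    patternColour-fallingValley : y < x → y < z → z < x → patternColour x y z ≡ C
    patternColour-fallingValley y<x y<z z<x = by (x <? y) (y <? z) (x ≤? z)
      where
      by : (x<y? : Dec (x < y)) (y<z? : Dec (y < z)) (x≤z? : Dec (x ≤ z)) →
           colourBy x<y? y<z? x≤z? ≡ C
      by (no  _)   (yes _)   (no  _)   = refl
      by (yes x<y) _         _         = contradiction x<y (<-asym y<x)
      by (no  _)   (no  y≮z) _         = contradiction y<z y≮z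
      by (no  _)   (yes _)   (yes x≤z) = contradiction x≤z (<⇒≱ z<x)

  quadColour : List ℕ → Subset r
  quadColour (a ∷ b ∷ c ∷ d ∷ []) = patternColour (δ N a b) (δ N b c) (δ N c d)
  quadColour _                    = A

  ∣quadColour∣ : ∀ xs → ∣ quadColour xs ∣ ≡ s
  ∣quadColour∣ (a ∷ b ∷ c ∷ d ∷ [])  = ∣patternColour∣ (δ N a b) (δ N b c) (δ N c d)
  ∣quadColour∣ []                    = ∣A∣≡s
  ∣quadColour∣ (_ ∷ [])              = ∣A∣≡s
  ∣quadColour∣ (_ ∷ _ ∷ [])          = ∣A∣≡s
  ∣quadColour∣ (_ ∷ _ ∷ _ ∷ [])      = ∣A∣≡s
  ∣quadColour∣ (_ ∷ _ ∷ _ ∷ _ ∷ _ ∷ _) = ∣A∣≡s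

  steppedColouring : ∀ {M} → Subset M → Subset r
  steppedColouring e = quadColour (elements e)

  steppedColouring-valid : ∀ M → IsRSColoring 4 M r s steppedColouring
  steppedColouring-valid M e _ = ∣quadColour∣ (elements e)

  triangleClique : ∀ {n c} (ys : List ℕ) → Increasing ys → length ys ≡ n → All (_< N) ys →
    (∀ {x y z} → x ∈ ys → y ∈ ys → z ∈ ys → x < y → y < z → c ∈ₛ triangleColour x y z) →
    HasMonoClique 3 n N r χ₃
  triangleClique {c = c} ys ys↗ length≡n ys<N coloured =
    fromList N ys , trans (∣fromList∣ ys↗ ys<N) length≡n , c , edge-coloured
    where
    edge-coloured : ∀ e → e ⊆ₛ fromList N ys → ∣ e ∣ ≡ 3 → c ∈ₛ χ₃ e
    edge-coloured e e⊆ ∣e∣≡3 with elements-of-triple e ∣e∣≡3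
    ... | x , y , z , elements≡ = subst (c ∈ₛ_) χ₃-edge (coloured x∈ys y∈ys z∈ys x<y y<z)
      where
      e↗ : Increasing (x ∷ y ∷ z ∷ [])
      e↗ = subst Increasing elements≡ (elements-increasing e)
      x<y = All.head (AllPairs.head e↗)
      y<z = All.head (AllPairs.head (AllPairs.tail e↗))
      ∈ys : ∀ {w} → w ∈ x ∷ y ∷ z ∷ [] → w ∈ ys
      ∈ys {w} w∈ with ∈-elements⁻ e (subst (w ∈_) (sym elements≡) w∈)
      ... | i , i≡w , i∈e = subst (_∈ ys) i≡w (∈-fromList⁻ ys (e⊆ i∈e))
      x∈ys = ∈ys (here refl)
      y∈ys = ∈ys (there (here refl))
      z∈ys = ∈ys (there (there (here refl)))
      χ₃-edge : triangleColour x y z ≡ χ₃ e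
      χ₃-edge = begin
        triangleColour x y z                 ≡⟨ triangleColour-≡ x<y y<z (All.lookup ys<N z∈ys) ⟩
        χ₃ (fromList N (x ∷ y ∷ z ∷ []))     ≡⟨ cong (χ₃ ∘ fromList N) (sym elements≡) ⟩
        χ₃ (fromList N (elements e))         ≡⟨ cong χ₃ (fromList-elements e) ⟩
        χ₃ e                                 ∎
        where open ≡-Reasoning

  module _ {M m : ℕ} (M≤2^N : M ≤ 2 ^ N) (S : Subset M) (∣S∣≡m : ∣ S ∣ ≡ m) where

    vertex : ℕ → ℕ
    vertex = nth (elements S)

    vertex-∈ : ∀ {i} → i < m → vertex i ∈ elements S
    vertex-∈ i<m = nth-∈ (elements S) (subst (_ <_) (∣p∣≡length-elements S) (subst (_ <_) (sym ∣S∣≡m) i<m))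

    vertex-mono : ∀ {i j} → i < j → j < m → vertex i < vertex j
    vertex-mono i<j j<m = nth-increasing (elements-increasing S) i<j
      (subst (_ <_) (∣p∣≡length-elements S) (subst (_ <_) (sym ∣S∣≡m) j<m))

    vertex-<2^N : ∀ {i} → i < m → vertex i < 2 ^ N
    vertex-<2^N i<m = <-≤-trans (elements-< S (vertex-∈ i<m)) M≤2^N

    deltaSystem : DeltaSystem m N
    deltaSystem = record
      { Δ          = λ p q → δ N (vertex p) (vertex q)
      ; Δ-join     = λ p<q q<u u<m → δ-join N (vertex-mono p<q (<-trans q<u u<m)) (vertex-mono q<u u<m) (vertex-<2^N u<m)
      ; Δ-distinct = λ p<q q<u u<m → δ-distinct N (vertex-mono p<q (<-trans q<u u<m)) (vertex-mono q<u u<m) (vertex-<2^N u<m)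
      ; Δ-<        = λ p<q q<m → δ-< N (vertex-mono p<q q<m) (vertex-<2^N q<m)
      }

    open DeltaSystem deltaSystem using (Δ)

    module _ {c : Fin r} (monochromatic : ∀ e → e ⊆ₛ S → ∣ e ∣ ≡ 4 → c ∈ₛ steppedColouring e) where

      c∈patternColour : ∀ {p q u v} → p < q → q < u → u < v → v < m → c ∈ₛ patternColour (Δ p q) (Δ q u) (Δ u v)
      c∈patternColour {p} {q} {u} {v} p<q q<u u<v v<m =
        subst (λ ws → c ∈ₛ quadColour ws) (elements-fromList ws↗ ws<M)
              (monochromatic (fromList M ws) (fromList-⊆ ws∈S) (∣fromList∣ ws↗ ws<M))
        where
        u<m = <-trans u<v v<m
        q<m = <-trans q<u u<m
        p<m = <-trans p<q q<m
        p<v = <-trans p<q (<-trans q<u u<v)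
        ws = vertex p ∷ vertex q ∷ vertex u ∷ vertex v ∷ []
        ws↗ : Increasing ws
        ws↗ = (vertex-mono p<q q<m ∷ vertex-mono (<-trans p<q q<u) u<m ∷ vertex-mono p<v v<m ∷ [])
            ∷ increasing-triple (vertex-mono q<u u<m) (vertex-mono u<v v<m)
        ws∈S : All (_∈ elements S) ws
        ws∈S = vertex-∈ p<m ∷ vertex-∈ q<m ∷ vertex-∈ u<m ∷ vertex-∈ v<m ∷ []
        ws<M : All (_< M) ws
        ws<M = All.map (elements-< S) ws∈S

      patternFree : PeakFree deltaSystem ⊎ RisingValleyFree deltaSystem ⊎ FallingValleyFree deltaSystem
      patternFree with no-common c
      ... | inj₁ c∉A = inj₁ λ p<q q<u u<v v<m (x<y , z<y) →
              c∉A (subst (c ∈ₛ_) (patternColour-peak x<y z<y) (c∈patternColour p<q q<u u<v v<m))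
      ... | inj₂ (inj₁ c∉B) = inj₂ (inj₁ λ p<q q<u u<v v<m (y<x , y<z , x<z) →
              c∉B (subst (c ∈ₛ_) (patternColour-risingValley y<x y<z x<z) (c∈patternColour p<q q<u u<v v<m)))
      ... | inj₂ (inj₂ c∉C) = inj₂ (inj₂ λ p<q q<u u<v v<m (y<x , y<z , z<x) →
              c∉C (subst (c ∈ₛ_) (patternColour-fallingValley y<x y<z z<x) (c∈patternColour p<q q<u u<v v<m)))

      c∈realised : ∀ {x y z} → x < y → y < z → Realised deltaSystem x y z → c ∈ₛ triangleColour x y z
      c∈realised x<y y<z (realised p<q q<u u<v v<m (inj₁ (refl , refl , refl))) =
        subst (c ∈ₛ_) (patternColour-rising x<y y<z) (c∈patternColour p<q q<u u<v v<m)
      c∈realised x<y y<z (realised p<q q<u u<v v<m (inj₂ (refl , refl , refl))) =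
        subst (c ∈ₛ_) (patternColour-falling y<z x<y) (c∈patternColour p<q q<u u<v v<m)

      monochromatic-triangles : ∀ {n} → RealisedSet deltaSystem n → HasMonoClique 3 n N r χ₃
      monochromatic-triangles D = triangleClique values increasing size bounded
        λ x∈ y∈ z∈ x<y y<z → c∈realised x<y y<z (realises x∈ y∈ z∈ x<y y<z)
        where open RealisedSet D

  stepDown : ∀ {M m n} → M ≤ 2 ^ N → 0 < n → n + n < m → n * n < m →
    HasMonoClique 4 m M r steppedColouring → HasMonoClique 3 n N r χ₃
  stepDown M≤2^N 0<n 2n<m n²<m (S , ∣S∣≡m , _ , monochromatic) =
    monochromatic-triangles M≤2^N S ∣S∣≡m monochromatic
      (realisedSet (deltaSystem M≤2^N S ∣S∣≡m) 0<n 2n<m n²<m (patternFree M≤2^N S ∣S∣≡m monochromatic))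

2n²≡n²+n² : ∀ n → 2 * n ^ 2 ≡ n * n + n * n
2n²≡n²+n² n = trans (cong (λ x → 2 * (n * x)) (*-identityʳ n)) (cong (n * n +_) (+-identityʳ (n * n)))

n²<2n² : ∀ n → 0 < n → n * n < 2 * n ^ 2
n²<2n² n@(suc k) _ = subst (n * n <_) (sym (2n²≡n²+n² n)) (m<m+n (n * n) (<-≤-trans z<s (m≤m+n n (k * n))))

2n<2n² : ∀ n → 1 < n → n + n < 2 * n ^ 2
2n<2n² n@(suc _) 1<n = subst (n + n <_) (sym (2n²≡n²+n² n)) (+-mono-< (m<m*n n n 1<n) (m<m*n n n 1<n))

theorem5p4 : (N n r s : ℕ) → 0 < N → 0 < r → 1 ≤ s → s < r → 3 < n →
    3 * s ≤ 2 * r → RamseyGreater 3 n r s N →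
    RamseyGreater 4 (2 * n ^ 2) r s (2 ^ N)
theorem5p4 N n r s _ _ _ _ 3<n 3s≤2r noMonoTriangles M M≤2^N ramsey₄ =
  noMonoTriangles N ≤-refl λ χ₃ χ₃-valid →
    let open SteppingUp χ₃ χ₃-valid (threeWayDisjoint 3s≤2r) in
    stepDown M≤2^N 0<n (2n<2n² n 1<n) (n²<2n² n 0<n) (ramsey₄ steppedColouring (steppedColouring-valid M))
  where
  1<n = <-trans (s<s z<s) 3<n
  0<n = <-trans z<s 1<n
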